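{- Let $H=(V,E)$ be a finite hypergraph that has at least one bad partition, and let $\mathcal P=\{V_1,\dots,V_k\}$ be a bad partition of $V$ maximizing $$f(\mathcal P)=|\mathcal P|\frac{|V|-1}{|V|}-N(\mathcal P)$$ among all bad partitions. Then: (1) If $H'$ is a maximal (with respect to inclusion) partition-connected subhypergraph of $H$, then $V(H')\subseteq V_i$ for some $i$. (2) If $H'$ is a maximal partition-connected subhypergraph of $H$ with $V(H')\subseteq V_i$, then $V(H')=V_i$. (3) In particular, if $H_1,\dots,H_k$ are the maximal partition-connected subhypergraphs of $H$, then their vertex sets form a partition of $V$, and this partition is a bad partition. Hence such a maximizing bad partition is unique, and it consists of the vertex sets of all the maximal partition-connected subhypergraphs of $H$.
   Context: A hypergraph has a finite vertex set and a set of nonempty vertex subsets as edges; a subhypergraph $(V',E')$ of $H$ has $V'\subseteq V$, $E'\subseteq E$ with every edge of $E'$ contained in $V'$. For a partition $\mathcal P$ of $V$ into nonempty parts, $N(\mathcal P)$ is the number of edges of $E$ having vertices in at least two parts of $\mathcal P$. A partition $\mathcal P$ is good if $N(\mathcal P)\ge|\mathcal P|-1$ and bad otherwise. A hypergraph is partition-connected if every partition of its vertex set (with $N$ computed using its own edges) is good. -}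

module Defs where

open import Data.Nat using (ℕ; _≤_; _∸_; _*_; _+_)
open import Data.Fin using (Fin; _≟_)
open import Data.Fin.Properties using (any?)
open import Data.Fin.Subset using (Subset; _∈_; _⊆_; ⊤)
open import Data.Fin.Subset.Properties using (_∈?_)
open import Data.List using (List; length; filter)
open import Data.List.Base using (allFin)
open import Data.Product using (Σ; ∃; _×_; _,_)
open import Relation.Nullary using (¬_; Dec; ¬?)
open import Relation.Nullary.Decidable using (_×-dec_)
open import Relation.Binary.PropositionalEquality using (_≡_; _≢_)
open import Function.Definitions using (Injective)

record Hypergraph : Set where
  field
    n     : ℕ
    m     : ℕ
    edge  : Fin m → Subset n
    edge-nonempty : ∀ j → ∃ λ v → v ∈ edge j
    edge-injective : Injective _≡_ _≡_ edge
open Hypergraph public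

record Sub (H : Hypergraph) : Set where
  constructor sub
  field
    verts : Subset (n H)
    edges : Subset (m H)
    closed : ∀ j → j ∈ edges → edge H j ⊆ verts
open Sub public

-- A partition of a vertex set V' into k nonempty (labelled) parts:
-- p v is the index of the part containing v (values outside V' are irrelevant);
-- every label is used by some vertex of V'.
IsPartition : ∀ {n} (V' : Subset n) (k : ℕ) (p : Fin n → Fin k) → Set
IsPartition V' k p = ∀ i → ∃ λ v → v ∈ V' × p v ≡ i

Crosses : ∀ {n k} (p : Fin n → Fin k) (e : Subset n) → Set
Crosses p e = ∃ λ u → ∃ λ v → u ∈ e × v ∈ e × p u ≢ p v

crosses? : ∀ {n k} (p : Fin n → Fin k) (e : Subset n) → Dec (Crosses p e)
crosses? p e = any? λ u → any? λ v → (u ∈? e) ×-dec ((v ∈? e) ×-dec ¬? (p u ≟ p v))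

Ncount : (H : Hypergraph) (E' : Subset (m H)) {k : ℕ} (p : Fin (n H) → Fin k) → ℕ
Ncount H E' p = length (filter (λ j → (j ∈? E') ×-dec crosses? p (edge H j)) (allFin (m H)))

Good : (H : Hypergraph) (E' : Subset (m H)) (k : ℕ) (p : Fin (n H) → Fin k) → Set
Good H E' k p = k ∸ 1 ≤ Ncount H E' p

Bad : (H : Hypergraph) (E' : Subset (m H)) (k : ℕ) (p : Fin (n H) → Fin k) → Set
Bad H E' k p = ¬ Good H E' k p

PartitionConnected : (H : Hypergraph) → Sub H → Set
PartitionConnected H S =
  ∀ k (p : Fin (n H) → Fin k) → IsPartition (verts S) k p → Good H (edges S) k p

MaximalPC : (H : Hypergraph) → Sub H → Set
MaximalPC H S = PartitionConnected H S ×
  (∀ (T : Sub H) → PartitionConnected H T →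
     verts S ⊆ verts T → edges S ⊆ edges T →
     verts T ⊆ verts S × edges T ⊆ edges S)

BadPartition : (H : Hypergraph) (k : ℕ) (p : Fin (n H) → Fin k) → Set
BadPartition H k p = IsPartition ⊤ k p × Bad H ⊤ k p

-- f(P) = |P|(|V|-1)/|V| - N(P).  f(P) ≥ f(Q) is stated after multiplying by |V| > 0
-- (|V| > 0 whenever a bad partition exists) and moving the N-terms across:
-- k(|V|-1) + N(Q)|V| ≥ k'(|V|-1) + N(P)|V|.
fGeq : (H : Hypergraph) (k : ℕ) (p : Fin (n H) → Fin k)
       (k' : ℕ) (q : Fin (n H) → Fin k') → Set
fGeq H k p k' q =
  k' * (n H ∸ 1) + Ncount H ⊤ p * n H ≤ k * (n H ∸ 1) + Ncount H ⊤ q * n H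

MaxBad : (H : Hypergraph) (k : ℕ) (p : Fin (n H) → Fin k) → Set
MaxBad H k p = BadPartition H k p ×
  (∀ k' (q : Fin (n H) → Fin k') → BadPartition H k' q → fGeq H k p k' q)

-- Let P be a bad partition maximising f, with N crossing edges. If a partition-connected S
-- meets r ≥ 2 parts of P, then P restricted to V(S) is a partition of S into r parts, so at
-- least r − 1 edges of S cross it; merging those r parts into one loses all of these crossings
-- and r − 1 parts, so the merged partition is still bad and f grows by at least (r − 1)/|V|.
-- Dually, if the subhypergraph induced by a part V_i had a bad partition into r pieces, then
-- splitting V_i along it adds r − 1 parts but at most r − 2 crossing edges, so the result is
-- bad and f grows by (r − 1)(|V| − 1)/|V| − (r − 2) > 0 since r ≤ |V|. Hence every induced
-- part is partition-connected and every partition-connected subhypergraph lies inside a part,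
-- which pins down the maximal ones as exactly the induced parts.

module Submission where

open import Defs
open import Data.Nat using (ℕ; zero; suc; _+_; _*_; _∸_; _≤_; _<_; _≤?_; z≤n; s≤s; NonZero)
open import Data.Nat.Properties
  using ( ≤-trans; ≤-reflexive; ≤-pred; <-irrefl; ≰⇒>; <⇒≱; n<1+n; m≤m+n; m∸n≤m; m+[n∸m]≡n; +-comm
        ; +-mono-≤; +-monoʳ-≤; +-mono-<; +-monoʳ-<; *-monoˡ-≤; *-monoʳ-<; *-distribʳ-+
        ; +-commutativeSemigroup; module ≤-Reasoning)
open import Data.Nat.Tactic.RingSolver using (solve)
open import Algebra.Properties.CommutativeSemigroup +-commutativeSemigroup using (interchange)
open import Data.Empty using (⊥-elim)
open import Data.Fin using (Fin; zero; suc; _≟_; _↑ˡ_; _↑ʳ_; splitAt; punchIn; punchOut)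
open import Data.Fin.Properties
  using ( any?; suc-injective; nonZeroIndex; injective⇒≤
        ; punchOut-cong; punchOut-punchIn; punchInᵢ≢i; splitAt⁻¹-↑ˡ; splitAt⁻¹-↑ʳ)
open import Data.Fin.Subset using (Subset; _∈_; _⊆_; ⊤; ∁; ∣_∣; inside; outside)
open import Data.Fin.Subset.Properties using (_∈?_; _⊆?_; ∈⊤; x∉p⇒x∈∁p; x∈∁p⇒x∉p; ∣p∣≤n; ∣∁p∣≡n∸∣p∣)
open import Data.List using ([]; _∷_; length; filter; allFin)
open import Data.Product using (∃; ∃₂; _×_; _,_; proj₁; proj₂)
import Data.Product as Product
open import Data.Sum using (_⊎_; inj₁; inj₂; [_,_]; map₁; map₂)
open import Data.Vec as Vec using (tabulate; here; there)
open import Data.Vec.Properties using (lookup∘tabulate; []=⇒lookup; lookup⇒[]=)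
open import Function using (_∘_)
open import Function.Bundles using (_⇔_; mk⇔)
open import Relation.Nullary using (¬_; Dec; yes; no; does)
open import Relation.Nullary.Decidable using (_×-dec_; dec-true; decidable-stable)
open import Relation.Unary using (Pred; Decidable)
open import Relation.Binary.PropositionalEquality using (_≡_; _≢_; refl; sym; trans; cong; cong₂; subst; module ≡-Reasoning)

subset : ∀ {n} {P : Fin n → Set} → (∀ x → Dec (P x)) → Subset n
subset P? = tabulate (does ∘ P?)

module _ {n} {P : Fin n → Set} (P? : ∀ x → Dec (P x)) where

  ∈-subset⁺ : ∀ {x} → P x → x ∈ subset P?
  ∈-subset⁺ {x} px = lookup⇒[]= x _ (trans (lookup∘tabulate (does ∘ P?) x) (dec-true (P? x) px))

  ∈-subset⁻ : ∀ {x} → x ∈ subset P? → P x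
  ∈-subset⁻ {x} x∈ with P? x | trans (sym (lookup∘tabulate (does ∘ P?) x)) ([]=⇒lookup x∈)
  ... | yes px | _ = px
  ... | no _ | ()

rank : ∀ {K} {I : Subset K} {l} → l ∈ I → Fin ∣ I ∣
rank here = zero
rank (there {y = inside} l∈I) = suc (rank l∈I)
rank (there {y = outside} l∈I) = rank l∈I

rank-cong : ∀ {K} {I : Subset K} {l l'} (x : l ∈ I) (y : l' ∈ I) → l ≡ l' → rank x ≡ rank y
rank-cong here here _ = refl
rank-cong (there {y = inside} x) (there y) refl = cong suc (rank-cong x y refl)
rank-cong (there {y = outside} x) (there y) refl = rank-cong x y refl

rank-injective : ∀ {K} {I : Subset K} {l l'} (x : l ∈ I) (y : l' ∈ I) → rank x ≡ rank y → l ≡ l'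
rank-injective here here _ = refl
rank-injective here (there {y = inside} y) ()
rank-injective (there {y = inside} x) here ()
rank-injective (there {y = inside} x) (there y) e = cong suc (rank-injective x y (suc-injective e))
rank-injective (there {y = outside} x) (there y) e = cong suc (rank-injective x y e)

rank-surjective : ∀ {K} {I : Subset K} (a : Fin ∣ I ∣) → ∃₂ λ l (x : l ∈ I) → rank x ≡ a
rank-surjective {I = inside Vec.∷ _} zero = zero , here , refl
rank-surjective {I = inside Vec.∷ _} (suc a) with rank-surjective a
... | l , x , e = suc l , there x , cong suc e
rank-surjective {I = outside Vec.∷ _} a with rank-surjective a
... | l , x , e = suc l , there x , e

∣p∣+∣∁p∣≡n : ∀ {n} (p : Subset n) → ∣ p ∣ + ∣ ∁ p ∣ ≡ n
∣p∣+∣∁p∣≡n p = trans (cong (∣ p ∣ +_) (∣∁p∣≡n∸∣p∣ p)) (m+[n∸m]≡n (∣p∣≤n p))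

module _ {n k} (f : Fin n → Fin k) (X : Subset n) where

  private
    hit? : ∀ l → Dec (∃ λ v → v ∈ X × f v ≡ l)
    hit? l = any? λ v → (v ∈? X) ×-dec (f v ≟ l)

  image : Subset k
  image = subset hit?

  ∈-image⁺ : ∀ {v} → v ∈ X → f v ∈ image
  ∈-image⁺ {v} v∈X = ∈-subset⁺ hit? (v , v∈X , refl)

  ∈-image⁻ : ∀ {l} → l ∈ image → ∃ λ v → v ∈ X × f v ≡ l
  ∈-image⁻ = ∈-subset⁻ hit?

module _ {K} (I : Subset K) where

  -- d is a junk value for the labels outside I.
  compress : Fin ∣ I ∣ → Fin K → Fin ∣ I ∣
  compress d l with l ∈? I
  ... | yes l∈I = rank l∈I
  ... | no _ = d

  compress-∈ : ∀ {d l} (x : l ∈ I) → compress d l ≡ rank x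
  compress-∈ {l = l} x with l ∈? I
  ... | yes y = rank-cong y x refl
  ... | no l∉I = ⊥-elim (l∉I x)

  merge : Fin K → Fin (suc ∣ ∁ I ∣)
  merge l with l ∈? I
  ... | yes _ = zero
  ... | no l∉I = suc (rank (x∉p⇒x∈∁p l∉I))

  merge-∈ : ∀ {l} → l ∈ I → merge l ≡ zero
  merge-∈ {l} x with l ∈? I
  ... | yes _ = refl
  ... | no l∉I = ⊥-elim (l∉I x)

  merge-∁ : ∀ {l} (x : l ∈ ∁ I) → merge l ≡ suc (rank x)
  merge-∁ {l} x with l ∈? I
  ... | yes y = ⊥-elim (x∈∁p⇒x∉p x y)
  ... | no l∉I = cong suc (rank-cong (x∉p⇒x∈∁p l∉I) x refl)

module _ {n k} (f : Fin n → Fin k) (X : Subset n) (d : Fin ∣ image f X ∣) where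

  compress-partition : IsPartition X ∣ image f X ∣ (compress (image f X) d ∘ f)
  compress-partition a with rank-surjective a
  ... | l , l∈I , rank≡a with ∈-image⁻ f X l∈I
  ... | v , v∈X , fv≡l = v , v∈X , (begin
    compress (image f X) d (f v) ≡⟨ compress-∈ (image f X) (∈-image⁺ f X v∈X) ⟩
    rank (∈-image⁺ f X v∈X)     ≡⟨ rank-cong (∈-image⁺ f X v∈X) l∈I fv≡l ⟩
    rank l∈I                    ≡⟨ rank≡a ⟩
    a                           ∎)
    where open ≡-Reasoning

  compress-injective : ∀ {u v} → u ∈ X → v ∈ X →
    compress (image f X) d (f u) ≡ compress (image f X) d (f v) → f u ≡ f v
  compress-injective {u} {v} u∈X v∈X e = rank-injective (∈-image⁺ f X u∈X) (∈-image⁺ f X v∈X) (begin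
    rank (∈-image⁺ f X u∈X)      ≡⟨ compress-∈ (image f X) (∈-image⁺ f X u∈X) ⟨
    compress (image f X) d (f u) ≡⟨ e ⟩
    compress (image f X) d (f v) ≡⟨ compress-∈ (image f X) (∈-image⁺ f X v∈X) ⟩
    rank (∈-image⁺ f X v∈X)      ∎)
    where open ≡-Reasoning

merge-partition : ∀ {n k} {X : Subset n} {p : Fin n → Fin k} (I : Subset k) {l} →
  IsPartition X k p → l ∈ I → IsPartition X (suc ∣ ∁ I ∣) (merge I ∘ p)
merge-partition I {l} part l∈I zero with part l
... | v , v∈X , pv≡l = v , v∈X , merge-∈ I (subst (_∈ I) (sym pv≡l) l∈I)
merge-partition I part _ (suc a) with rank-surjective a
... | l , l∈∁I , rank≡a with part l
... | v , v∈X , pv≡l = v , v∈X , trans (merge-∁ I pv∈∁I) (cong suc (trans (rank-cong pv∈∁I l∈∁I pv≡l) rank≡a))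
  where pv∈∁I = subst (_∈ ∁ I) (sym pv≡l) l∈∁I

module _ {a ℓ} {A : Set a} {P Q R : Pred A ℓ} (P? : Decidable P) (Q? : Decidable Q) (R? : Decidable R) where

  private
    χ : ∀ {B : Set ℓ} → Dec B → ℕ
    χ (yes _) = 1
    χ (no _) = 0

    length-filter-∷ : ∀ {B : Pred A ℓ} (B? : Decidable B) x xs →
      length (filter B? (x ∷ xs)) ≡ χ (B? x) + length (filter B? xs)
    length-filter-∷ B? x xs with B? x
    ... | yes _ = refl
    ... | no _ = refl

  length-filter-≤-+ : (∀ {x} → P x → Q x ⊎ R x) → ∀ xs →
    length (filter P? xs) ≤ length (filter Q? xs) + length (filter R? xs)
  length-filter-≤-+ P⇒Q⊎R [] = z≤n
  length-filter-≤-+ P⇒Q⊎R (x ∷ xs) = begin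
    length (filter P? (x ∷ xs))                        ≡⟨ length-filter-∷ P? x xs ⟩
    χ (P? x) + length (filter P? xs)                   ≤⟨ +-mono-≤ χ-step (length-filter-≤-+ P⇒Q⊎R xs) ⟩
    (χ (Q? x) + χ (R? x)) + (length (filter Q? xs) + length (filter R? xs))
      ≡⟨ interchange (χ (Q? x)) _ _ _ ⟩
    (χ (Q? x) + length (filter Q? xs)) + (χ (R? x) + length (filter R? xs))
      ≡⟨ cong₂ _+_ (length-filter-∷ Q? x xs) (length-filter-∷ R? x xs) ⟨
    length (filter Q? (x ∷ xs)) + length (filter R? (x ∷ xs)) ∎
    where
    open ≤-Reasoning
    χ-step : χ (P? x) ≤ χ (Q? x) + χ (R? x)
    χ-step with P? x | Q? x | R? x
    ... | no _  | _     | _     = z≤n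
    ... | yes _ | yes _ | _     = s≤s z≤n
    ... | yes _ | no _  | yes _ = s≤s z≤n
    ... | yes p | no ¬q | no ¬r = ⊥-elim ([ ¬q , ¬r ] (P⇒Q⊎R p))

  length-filter-+-≤ : (∀ {x} → P x → R x) → (∀ {x} → Q x → R x) → (∀ {x} → P x → ¬ Q x) → ∀ xs →
    length (filter P? xs) + length (filter Q? xs) ≤ length (filter R? xs)
  length-filter-+-≤ P⇒R Q⇒R P⇒¬Q [] = z≤n
  length-filter-+-≤ P⇒R Q⇒R P⇒¬Q (x ∷ xs) = begin
    length (filter P? (x ∷ xs)) + length (filter Q? (x ∷ xs))
      ≡⟨ cong₂ _+_ (length-filter-∷ P? x xs) (length-filter-∷ Q? x xs) ⟩
    (χ (P? x) + length (filter P? xs)) + (χ (Q? x) + length (filter Q? xs))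
      ≡⟨ interchange (χ (P? x)) _ _ _ ⟩
    (χ (P? x) + χ (Q? x)) + (length (filter P? xs) + length (filter Q? xs))
      ≤⟨ +-mono-≤ χ-step (length-filter-+-≤ P⇒R Q⇒R P⇒¬Q xs) ⟩
    χ (R? x) + length (filter R? xs)                   ≡⟨ length-filter-∷ R? x xs ⟨
    length (filter R? (x ∷ xs))                        ∎
    where
    open ≤-Reasoning
    χ-step : χ (P? x) + χ (Q? x) ≤ χ (R? x)
    χ-step with P? x | Q? x | R? x
    ... | yes p | yes q | _     = ⊥-elim (P⇒¬Q p q)
    ... | no _  | no _  | _     = z≤n
    ... | yes _ | no _  | yes _ = s≤s z≤n
    ... | no _  | yes _ | yes _ = s≤s z≤n
    ... | yes p | no _  | no ¬r = ⊥-elim (¬r (P⇒R p))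
    ... | no _  | yes q | no ¬r = ⊥-elim (¬r (Q⇒R q))

module _ {n k} {p : Fin n → Fin k} {e : Subset n} where

  ¬Crosses⇒constant : ¬ Crosses p e → ∀ {u v} → u ∈ e → v ∈ e → p u ≡ p v
  ¬Crosses⇒constant ¬c {u} {v} u∈e v∈e with p u ≟ p v
  ... | yes pu≡pv = pu≡pv
  ... | no pu≢pv = ⊥-elim (¬c (u , v , u∈e , v∈e , pu≢pv))

  constant⇒¬Crosses : ∀ {c} → (∀ {v} → v ∈ e → p v ≡ c) → ¬ Crosses p e
  constant⇒¬Crosses p≡c (u , v , u∈e , v∈e , pu≢pv) = pu≢pv (trans (p≡c u∈e) (sym (p≡c v∈e)))

  Crosses-∘ : ∀ {k'} (g : Fin k → Fin k') → Crosses (g ∘ p) e → Crosses p e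
  Crosses-∘ g (u , v , u∈e , v∈e , gpu≢gpv) = u , v , u∈e , v∈e , gpu≢gpv ∘ cong g

module _ (H : Hypergraph) where

  private
    crossing? : ∀ {k} (E' : Subset (m H)) (p : Fin (n H) → Fin k) j → Dec (j ∈ E' × Crosses p (edge H j))
    crossing? E' p j = (j ∈? E') ×-dec crosses? p (edge H j)

  Ncount-merge : ∀ {k k₁ k₂} {E' : Subset (m H)} (p : Fin (n H) → Fin k) (g : Fin k → Fin k₁) (f : Fin k → Fin k₂) →
    (∀ {j} → j ∈ E' → ¬ Crosses (g ∘ p) (edge H j)) →
    Ncount H ⊤ (g ∘ p) + Ncount H E' (f ∘ p) ≤ Ncount H ⊤ p
  Ncount-merge {E' = E'} p g f E'-uncrossed =
    length-filter-+-≤ (crossing? ⊤ (g ∘ p)) (crossing? E' (f ∘ p)) (crossing? ⊤ p)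
      (λ (_ , c) → ∈⊤ , Crosses-∘ g c) (λ (_ , c) → ∈⊤ , Crosses-∘ f c)
      (λ (_ , c) (j∈E' , _) → E'-uncrossed j∈E' c) (allFin (m H))

  Ncount-split : ∀ {k r k'} {E' : Subset (m H)} (p : Fin (n H) → Fin k) (ρ : Fin (n H) → Fin r) (q : Fin (n H) → Fin k') →
    (∀ {j} → Crosses q (edge H j) → Crosses p (edge H j) ⊎ (j ∈ E' × Crosses ρ (edge H j))) →
    Ncount H ⊤ q ≤ Ncount H ⊤ p + Ncount H E' ρ
  Ncount-split {E' = E'} p ρ q q⇒p⊎ρ =
    length-filter-≤-+ (crossing? ⊤ q) (crossing? ⊤ p) (crossing? E' ρ)
      (λ (_ , c) → map₁ (∈⊤ ,_) (q⇒p⊎ρ c)) (allFin (m H))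

part : ∀ {n k} → (Fin n → Fin k) → Fin k → Subset n
part p i = subset (λ v → p v ≟ i)

module _ {n k} (p : Fin n → Fin k) {i : Fin k} where

  ∈-part⁺ : ∀ {v} → p v ≡ i → v ∈ part p i
  ∈-part⁺ = ∈-subset⁺ (λ v → p v ≟ i)

  ∈-part⁻ : ∀ {v} → v ∈ part p i → p v ≡ i
  ∈-part⁻ = ∈-subset⁻ (λ v → p v ≟ i)

induced : (H : Hypergraph) → Subset (n H) → Sub H
induced H X = sub X (subset (λ j → edge H j ⊆? X)) (λ j → ∈-subset⁻ (λ j → edge H j ⊆? X))

∈-induced⁺ : ∀ {H X j} → edge H j ⊆ X → j ∈ edges (induced H X)
∈-induced⁺ {H} {X} = ∈-subset⁺ (λ j → edge H j ⊆? X)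

module _ {n k₀ r} (p : Fin n → Fin (suc k₀)) (i : Fin (suc k₀)) (ρ : Fin n → Fin r) where

  split : Fin n → Fin (r + k₀)
  split v with p v ≟ i
  ... | yes _ = ρ v ↑ˡ k₀
  ... | no pv≢i = r ↑ʳ punchOut (pv≢i ∘ sym)

  split-in : ∀ {v} → p v ≡ i → split v ≡ ρ v ↑ˡ k₀
  split-in {v} pv≡i with p v ≟ i
  ... | yes _ = refl
  ... | no pv≢i = ⊥-elim (pv≢i pv≡i)

  split-out : ∀ {v} (pv≢i : p v ≢ i) → split v ≡ r ↑ʳ punchOut (pv≢i ∘ sym)
  split-out {v} pv≢i with p v ≟ i
  ... | yes pv≡i = ⊥-elim (pv≢i pv≡i)
  ... | no _ = cong (r ↑ʳ_) (punchOut-cong i refl)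

  split-partition : IsPartition ⊤ (suc k₀) p → IsPartition (part p i) r ρ → IsPartition ⊤ (r + k₀) split
  split-partition p-partition ρ-partition l with splitAt r l in eq
  ... | inj₁ a with ρ-partition a
  ...   | v , v∈Vᵢ , ρv≡a = v , ∈⊤ , (begin
    split v    ≡⟨ split-in (∈-part⁻ p v∈Vᵢ) ⟩
    ρ v ↑ˡ k₀  ≡⟨ cong (_↑ˡ k₀) ρv≡a ⟩
    a ↑ˡ k₀    ≡⟨ splitAt⁻¹-↑ˡ eq ⟩
    l          ∎)
    where open ≡-Reasoning
  split-partition p-partition ρ-partition l | inj₂ b with p-partition (punchIn i b)
  ... | v , _ , pv≡ = v , ∈⊤ , (begin
    split v                           ≡⟨ split-out pv≢i ⟩
    r ↑ʳ punchOut (pv≢i ∘ sym)        ≡⟨ cong (r ↑ʳ_) (trans (punchOut-cong i pv≡) (punchOut-punchIn i)) ⟩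
    r ↑ʳ b                            ≡⟨ splitAt⁻¹-↑ʳ eq ⟩
    l                                 ∎)
    where
    open ≡-Reasoning
    pv≢i : p v ≢ i
    pv≢i pv≡i = punchInᵢ≢i i b (trans (sym pv≡) pv≡i)

  split-crosses : ∀ {e} → Crosses split e → Crosses p e ⊎ (e ⊆ part p i × Crosses ρ e)
  split-crosses {e} (u , v , u∈e , v∈e , split-differs) with crosses? p e
  ... | yes p-crosses = inj₁ p-crosses
  ... | no ¬p-crosses = inj₂ (e⊆Vᵢ , u , v , u∈e , v∈e , ρ-differs)
    where
    open ≡-Reasoning
    p-constant : ∀ {w} → w ∈ e → p w ≡ p u
    p-constant w∈e = ¬Crosses⇒constant ¬p-crosses w∈e u∈e
    pu≡i : p u ≡ i
    pu≡i = decidable-stable (p u ≟ i) λ pu≢i →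
      let pv≢i = pu≢i ∘ trans (sym (p-constant v∈e)) in
      split-differs (begin
        split u                     ≡⟨ split-out pu≢i ⟩
        r ↑ʳ punchOut (pu≢i ∘ sym)  ≡⟨ cong (r ↑ʳ_) (punchOut-cong i (sym (p-constant v∈e))) ⟩
        r ↑ʳ punchOut (pv≢i ∘ sym)  ≡⟨ split-out pv≢i ⟨
        split v                     ∎)
    e⊆Vᵢ : e ⊆ part p i
    e⊆Vᵢ w∈e = ∈-part⁺ p (trans (p-constant w∈e) pu≡i)
    ρ-differs : ρ u ≢ ρ v
    ρ-differs ρu≡ρv = split-differs (begin
      split u    ≡⟨ split-in pu≡i ⟩
      ρ u ↑ˡ k₀  ≡⟨ cong (_↑ˡ k₀) ρu≡ρv ⟩
      ρ v ↑ˡ k₀  ≡⟨ split-in (trans (p-constant v∈e) pu≡i) ⟨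
      split v    ∎)

partition-size≤ : ∀ {n r} {X : Subset n} {ρ : Fin n → Fin r} → IsPartition X r ρ → r ≤ n
partition-size≤ {ρ = ρ} ρ-partition = injective⇒≤ {f = representative} λ {a} {b} rep≡ →
  trans (sym (ρ-representative a)) (trans (cong ρ rep≡) (ρ-representative b))
  where
  representative = λ a → proj₁ (ρ-partition a)
  ρ-representative = λ a → proj₂ (proj₂ (ρ-partition a))

distinct⇒2≤ : ∀ {r} {a b : Fin r} → a ≢ b → 2 ≤ r
distinct⇒2≤ {suc zero} {zero} {zero} a≢b = ⊥-elim (a≢b refl)
distinct⇒2≤ {suc (suc _)} _ = s≤s (s≤s z≤n)

merge-stays-bad : ∀ {k r c N NQ NS} → r + c ≡ k → r ∸ 1 ≤ NS → NQ + NS ≤ N → c ≤ NQ → k ∸ 1 ≤ N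
merge-stays-bad {r = zero} {c} {NQ = NQ} {NS} refl _ NQ+NS≤N c≤NQ =
  ≤-trans (m∸n≤m c 1) (≤-trans c≤NQ (≤-trans (m≤m+n NQ NS) NQ+NS≤N))
merge-stays-bad {r = suc s} {c} {NQ = NQ} {NS} refl s≤NS NQ+NS≤N c≤NQ =
  ≤-trans (+-mono-≤ s≤NS c≤NQ) (≤-trans (≤-reflexive (+-comm NS NQ)) NQ+NS≤N)

merge-raises-f : ∀ {k r c N NQ NS n} .{{_ : NonZero n}} → r + c ≡ k → 2 ≤ r → r ∸ 1 ≤ NS → NQ + NS ≤ N →
  k * (n ∸ 1) + NQ * n < suc c * (n ∸ 1) + N * n
merge-raises-f {r = suc zero} _ (s≤s ()) _ _
merge-raises-f {r = suc (suc t)} {c} {N} {NQ} {NS} {suc n} refl _ t+1≤NS NQ+NS≤N = begin-strict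
  (suc (suc t) + c) * n + NQ * suc n         ≡⟨ solve (t ∷ c ∷ NQ ∷ n ∷ []) ⟩
  suc c * n + (NQ * suc n + suc t * n)       <⟨ +-monoʳ-< (suc c * n) (+-monoʳ-< (NQ * suc n) (*-monoʳ-< (suc t) (n<1+n n))) ⟩
  suc c * n + (NQ * suc n + suc t * suc n)   ≡⟨ cong (suc c * n +_) (*-distribʳ-+ (suc n) NQ (suc t)) ⟨
  suc c * n + (NQ + suc t) * suc n           ≤⟨ +-monoʳ-≤ (suc c * n) (*-monoˡ-≤ (suc n) NQ+t+1≤N) ⟩
  suc c * n + N * suc n                      ∎
  where
  open ≤-Reasoning
  NQ+t+1≤N = ≤-trans (+-monoʳ-≤ NQ t+1≤NS) NQ+NS≤N

split-stays-bad : ∀ {k₀ r N NR NQ} → NQ ≤ N + NR → ¬ (r ∸ 1 ≤ NR) → ¬ (k₀ ≤ N) → ¬ (r + k₀ ∸ 1 ≤ NQ)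
split-stays-bad {r = zero} _ ¬0≤NR _ _ = ¬0≤NR z≤n
split-stays-bad {k₀} {suc s} {N} {NR} {NQ} NQ≤N+NR ¬s≤NR ¬k₀≤N s+k₀≤NQ = <-irrefl refl (begin-strict
  s + k₀   ≤⟨ s+k₀≤NQ ⟩
  NQ       ≤⟨ NQ≤N+NR ⟩
  N + NR   <⟨ +-mono-< (≰⇒> ¬k₀≤N) (≰⇒> ¬s≤NR) ⟩
  k₀ + s   ≡⟨ +-comm k₀ s ⟩
  s + k₀   ∎)
  where open ≤-Reasoning

split-raises-f : ∀ {k₀ r N NR NQ n} → NQ ≤ N + NR → ¬ (r ∸ 1 ≤ NR) → r ≤ n →
  suc k₀ * (n ∸ 1) + NQ * n < (r + k₀) * (n ∸ 1) + N * n
split-raises-f {r = zero} _ ¬0≤NR _ = ⊥-elim (¬0≤NR z≤n)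
split-raises-f {r = suc zero} _ ¬0≤NR _ = ⊥-elim (¬0≤NR z≤n)
split-raises-f {k₀} {suc (suc t)} {N} {NR} {NQ} {suc n} NQ≤N+NR ¬t+1≤NR (s≤s t<n) = begin-strict
  suc k₀ * n + NQ * suc n              ≤⟨ +-monoʳ-≤ (suc k₀ * n) (*-monoˡ-≤ (suc n) NQ≤N+NR) ⟩
  suc k₀ * n + (N + NR) * suc n        ≤⟨ +-monoʳ-≤ (suc k₀ * n) (*-monoˡ-≤ (suc n) (+-monoʳ-≤ N NR≤t)) ⟩
  suc k₀ * n + (N + t) * suc n         ≡⟨ solve (t ∷ k₀ ∷ N ∷ n ∷ []) ⟩
  (suc t + k₀) * n + N * suc n + t     <⟨ +-monoʳ-< ((suc t + k₀) * n + N * suc n) t<n ⟩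
  (suc t + k₀) * n + N * suc n + n     ≡⟨ solve (t ∷ k₀ ∷ N ∷ n ∷ []) ⟩
  (suc (suc t) + k₀) * n + N * suc n   ∎
  where
  open ≤-Reasoning
  NR≤t = ≤-pred (≰⇒> ¬t+1≤NR)

module _ (H : Hypergraph) where

  pc-within-part : ∀ {k} {p : Fin (n H) → Fin k} → MaxBad H k p →
    ∀ S → PartitionConnected H S → ∀ {u v} → u ∈ verts S → v ∈ verts S → p u ≡ p v
  pc-within-part {k} {p} ((p-partition , p-bad) , p-max) S S-pc {u} {v} u∈S v∈S =
    decidable-stable (p u ≟ p v) λ pu≢pv →
      <⇒≱ (merge-raises-f {{nonZeroIndex u}} (∣p∣+∣∁p∣≡n I) (two-parts pu≢pv) ρ-good N-bound)
          (p-max (suc ∣ ∁ I ∣) Q (merge-partition I p-partition pu∈I , Q-bad))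
    where
    I = image p (verts S)
    pu∈I = ∈-image⁺ p (verts S) u∈S
    ρ = compress I (rank pu∈I) ∘ p
    Q = merge I ∘ p
    ρ-good : ∣ I ∣ ∸ 1 ≤ Ncount H (edges S) ρ
    ρ-good = S-pc ∣ I ∣ ρ (compress-partition p (verts S) (rank pu∈I))
    two-parts : p u ≢ p v → 2 ≤ ∣ I ∣
    two-parts pu≢pv = distinct⇒2≤ (pu≢pv ∘ compress-injective p (verts S) (rank pu∈I) u∈S v∈S)
    N-bound : Ncount H ⊤ Q + Ncount H (edges S) ρ ≤ Ncount H ⊤ p
    N-bound = Ncount-merge H p (merge I) (compress I (rank pu∈I)) λ {j} j∈S →
      constant⇒¬Crosses λ w∈e → merge-∈ I (∈-image⁺ p (verts S) (closed S j j∈S w∈e))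
    Q-bad : Bad H ⊤ (suc ∣ ∁ I ∣) Q
    Q-bad = p-bad ∘ merge-stays-bad (∣p∣+∣∁p∣≡n I) ρ-good N-bound

  part-pc : ∀ {k} {p : Fin (n H) → Fin k} → MaxBad H k p → ∀ i → PartitionConnected H (induced H (part p i))
  part-pc {k = zero} _ ()
  part-pc {suc k₀} {p} ((p-partition , p-bad) , p-max) i r ρ ρ-partition =
    decidable-stable (r ∸ 1 ≤? Ncount H (edges (induced H (part p i))) ρ) λ ρ-bad →
      <⇒≱ (split-raises-f N-bound ρ-bad (partition-size≤ ρ-partition))
          (p-max (r + k₀) q (split-partition p i ρ p-partition ρ-partition , split-stays-bad {r = r} N-bound ρ-bad p-bad))
    where
    q = split p i ρ
    N-bound : Ncount H ⊤ q ≤ Ncount H ⊤ p + Ncount H (edges (induced H (part p i))) ρ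
    N-bound = Ncount-split H p ρ q (map₂ (Product.map₁ (∈-induced⁺ {H})) ∘ split-crosses p i ρ)

  bad-part : ∀ {E k} {p : Fin (n H) → Fin k} → Bad H E k p → Fin k
  bad-part {k = zero} bad = ⊥-elim (bad z≤n)
  bad-part {k = suc _} _ = zero

  module _ {k} {p : Fin (n H) → Fin k} (maxBad : MaxBad H k p) where

    induced-part-maximal : ∀ i → MaximalPC H (induced H (part p i))
    induced-part-maximal i = part-pc maxBad i , λ T T-pc Vᵢ⊆T _ → T⊆Vᵢ T T-pc Vᵢ⊆T , λ {j} j∈T →
      ∈-induced⁺ {H} λ w∈e → T⊆Vᵢ T T-pc Vᵢ⊆T (closed T j j∈T w∈e)
      where
      T⊆Vᵢ : ∀ T → PartitionConnected H T → part p i ⊆ verts T → verts T ⊆ part p i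
      T⊆Vᵢ T T-pc Vᵢ⊆T v∈T with proj₁ (proj₁ maxBad) i
      ... | w , _ , pw≡i = ∈-part⁺ p (trans (pc-within-part maxBad T T-pc v∈T (Vᵢ⊆T (∈-part⁺ p pw≡i))) pw≡i)

    maximalPC-within-part : ∀ S → MaximalPC H S → ∃ λ i → ∀ v → v ∈ verts S → p v ≡ i
    maximalPC-within-part S (S-pc , _) with any? (_∈? verts S)
    ... | yes (u , u∈S) = p u , λ v v∈S → pc-within-part maxBad S S-pc v∈S u∈S
    ... | no S-empty = bad-part (proj₂ (proj₁ maxBad)) , λ v v∈S → ⊥-elim (S-empty (v , v∈S))

    maximalPC-covers-part : ∀ S {i} → MaximalPC H S → (∀ v → v ∈ verts S → p v ≡ i) → ∀ v → p v ≡ i → v ∈ verts S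
    maximalPC-covers-part S {i} (_ , S-max) S⊆Vᵢ v pv≡i =
      proj₁ (S-max (induced H (part p i)) (part-pc maxBad i) S⊆Vᵢ' (λ {j} j∈S → ∈-induced⁺ {H} (S⊆Vᵢ' ∘ closed S j j∈S)))
        (∈-part⁺ p pv≡i)
      where
      S⊆Vᵢ' : verts S ⊆ part p i
      S⊆Vᵢ' {v} v∈S = ∈-part⁺ p (S⊆Vᵢ v v∈S)

  same-part : ∀ {k k'} {p : Fin (n H) → Fin k} {q : Fin (n H) → Fin k'} → MaxBad H k p → MaxBad H k' q →
    ∀ {u v} → p u ≡ p v → q u ≡ q v
  same-part {p = p} p-maxBad q-maxBad {u} {v} pu≡pv =
    pc-within-part q-maxBad (induced H (part p (p u))) (part-pc p-maxBad (p u)) (∈-part⁺ p refl) (∈-part⁺ p (sym pu≡pv))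

theorem15 : (H : Hypergraph) (k : ℕ) (p : Fin (n H) → Fin k) → MaxBad H k p →
    (∀ (S : Sub H) → MaximalPC H S → ∃ λ i → ∀ v → v ∈ verts S → p v ≡ i)
    × (∀ (S : Sub H) (i : Fin k) → MaximalPC H S → (∀ v → v ∈ verts S → p v ≡ i) →
         ∀ v → p v ≡ i → v ∈ verts S)
    × (∀ (i : Fin k) → ∃ λ (S : Sub H) → MaximalPC H S × (∀ v → v ∈ verts S ⇔ p v ≡ i))
    × (∀ (S : Sub H) → MaximalPC H S → ∃ λ i → ∀ v → v ∈ verts S ⇔ p v ≡ i)
    × (∀ k' (q : Fin (n H) → Fin k') → MaxBad H k' q → ∀ u v → (p u ≡ p v ⇔ q u ≡ q v))
theorem15 H k p maxBad =
  maximalPC-within-part H maxBad ,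
  (λ S i → maximalPC-covers-part H maxBad S) ,
  (λ i → induced H (part p i) , induced-part-maximal H maxBad i , λ v → mk⇔ (∈-part⁻ p) (∈-part⁺ p)) ,
  (λ S S-max → let i , S⊆Vᵢ = maximalPC-within-part H maxBad S S-max in
    i , λ v → mk⇔ (S⊆Vᵢ v) (maximalPC-covers-part H maxBad S S-max S⊆Vᵢ v)) ,
  λ k' q q-maxBad u v → mk⇔ (same-part H maxBad q-maxBad) (same-part H q-maxBad maxBad)
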